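{- For an ordered forest $\mathcal F$ on $[n]$ let $$\pi(S^{\mathcal F})=\sum_{j} a_{j(1)}a_{j(2)}\cdots a_{j(n)},$$ the sum over all maps $j:[n]\to\mathbb Z_{>0}$ with $j(p(k))<j(k)$ for every non-root vertex $k$ with parent $p(k)$ (formal series in noncommuting variables $a_1,a_2,\dots$); equivalently, $\pi(S^{\mathcal F})$ is the image of $S^{\mathcal F}=\sum_j \prod_{k=1}^n a_{j(p(k))\,j(k)}$ (with $p(k)=k$ for roots) under $a_{ij}\mapsto a_j$. Then the restriction of $\pi$ to the noncommutative Connes–Kreimer algebra $\mathbf H_{NCK}$ is injective; that is, the elements $\pi(S^{\mathcal F})$, where $\mathcal F$ ranges over the ordered forests obtained from plane forests by the left depth-first (preorder) numbering of their vertices, are linearly independent.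
   Context: An ordered forest on $[n]$ is a rooted forest with vertex set $[n]$. A plane forest is a finite sequence of plane trees (rooted trees with the children of each vertex linearly ordered); it becomes an ordered forest by numbering its vertices in order of first encounter in a left depth-first traversal (trees from left to right, children from left to right). $\mathbf H_{NCK}$ is identified with the span of the corresponding $S^{\mathcal F}$. -}

module Defs where

open import Data.Nat using (ℕ; zero; suc; _+_; _<ᵇ_; _≡ᵇ_)
open import Data.Bool using (Bool; true; false; _∧_; if_then_else_)
open import Data.List using (List; []; _∷_; _++_; length; zip; map; foldr)
open import Data.Maybe using (Maybe; just; nothing)
open import Data.Product using (_×_; _,_)
open import Data.Rational using (ℚ; 0ℚ; 1ℚ) renaming (_+_ to _+ℚ_; _*_ to _*ℚ_)

data PTree : Set where
  node : List PTree → PTree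

PForest : Set
PForest = List PTree

-- Ordered forest obtained by the left depth-first (preorder) numbering.
-- Vertices are numbered 0,1,...,n-1 (standing for 1,...,n); the k-th entry of the
-- resulting list is the parent of vertex k (nothing for roots).
mutual
  parentsT : ℕ → Maybe ℕ → PTree → List (Maybe ℕ)
  parentsT i par (node ts) = par ∷ parentsF (suc i) (just i) ts

  parentsF : ℕ → Maybe ℕ → List PTree → List (Maybe ℕ)
  parentsF i par [] = []
  parentsF i par (t ∷ ts) =
    parentsT i par t ++ parentsF (i + length (parentsT i par t)) par ts

parents : PForest → List (Maybe ℕ)
parents F = parentsF 0 nothing F

allB : {A : Set} → (A → Bool) → List A → Bool
allB f [] = true
allB f (x ∷ xs) = f x ∧ allB f xs

-- k-th entry of a list of naturals (default 0; never used out of range below).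
nth : List ℕ → ℕ → ℕ
nth [] _ = 0
nth (x ∷ xs) zero = x
nth (x ∷ xs) (suc k) = nth xs k

-- A word  a_{w(1)} ... a_{w(n)}  in the noncommuting variables a_1, a_2, ...
-- is represented by the list of its indices.
admissible : List (Maybe ℕ) → List ℕ → Bool
admissible ps w =
  (length ps ≡ᵇ length w) ∧ (allB (λ x → 0 <ᵇ x) w ∧ allB ok (zip ps w))
  where
  ok : Maybe ℕ × ℕ → Bool
  ok (nothing , _) = true
  ok (just p , wk) = nth w p <ᵇ wk

-- Coefficient of the word w in π(S^F) = Σ_j a_{j(1)} ... a_{j(n)}:
-- the number of admissible maps j whose word is w, i.e. 1 if w itself is
-- admissible and 0 otherwise.
coeff : PForest → List ℕ → ℚ
coeff F w = if admissible (parents F) w then 1ℚ else 0ℚ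

sumℚ : List ℚ → ℚ
sumℚ = foldr _+ℚ_ 0ℚ

combCoeff : List (ℚ × PForest) → List ℕ → ℚ
combCoeff cs w = sumℚ (map (λ { (c , F) → c *ℚ coeff F w }) cs)

module Submission where

-- The elements π(S^F), F a plane forest, are linearly independent because
-- their coefficient matrix is unitriangular.  The leading word of F is its
-- depth word: the depths (roots having depth 1) of its vertices in preorder.
--
-- Hence any forest G admitting the depth
--    word of F is F itself or has smaller weight (sum of its depth word).

open import Defs
open import Data.Bool using (Bool; true; false; _∧_; T)
open import Data.Bool.Properties using (T-∧)
open import Data.Empty using (⊥-elim)
open import Data.List using (List; []; _∷_; _++_; length; zip; map; drop)
open import Data.List.Properties using (++-assoc; ++-identityʳ; drop-drop; length-++)
open import Data.List.Membership.Propositional using (_∈_)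
open import Data.List.Relation.Binary.Pointwise using (Pointwise; []; _∷_; ++⁺)
open import Data.List.Relation.Unary.All using (All; []; _∷_; tabulate)
import Data.List.Relation.Unary.All as All
import Data.List.Relation.Unary.All.Properties as All
open import Data.List.Relation.Unary.Any using (here; there)
open import Data.List.Relation.Unary.AllPairs using (_∷_)
open import Data.List.Relation.Unary.Unique.Propositional using (Unique)
open import Data.Maybe using (Maybe; just; nothing)
open import Data.Nat using (ℕ; zero; suc; _+_; _≤_; _<_; z≤n; s≤s; _<ᵇ_; _≡ᵇ_)
open import Data.Nat.Induction using (<-rec)
open import Data.Nat.ListAction using (sum)
open import Data.Nat.Properties
  using (≤-refl; ≤-trans; ≤-antisym; ≤-<-trans; n<1+n; 1+n≰n; m≤n⇒m≤1+n; m≤n⇒m<n∨m≡n;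
         +-mono-≤; +-monoʳ-≤; +-cancelʳ-≤; +-cancelˡ-≡; +-comm; +-suc; suc-injective;
         <ᵇ⇒<; <⇒<ᵇ; ≡ᵇ⇒≡; ≡⇒≡ᵇ; module ≤-Reasoning)
open import Data.Product using (Σ-syntax; _×_; _,_; proj₁; proj₂)
open import Data.Rational using (ℚ; 0ℚ; 1ℚ) renaming (_+_ to _+ℚ_; _*_ to _*ℚ_)
open import Data.Rational.Properties using (*-zeroˡ; *-zeroʳ; *-identityʳ; +-identityˡ; +-identityʳ)
open import Data.Sum using (_⊎_; inj₁; inj₂)
open import Data.Unit using (⊤; tt)
open import Function.Bundles using (_⇔_; mk⇔; Equivalence)
open import Relation.Binary.PropositionalEquality
  using (_≡_; _≢_; refl; sym; trans; cong; cong₂; subst; module ≡-Reasoning)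

module Triangular {I W : Set} (vec : I → W → ℚ) where

  comb : List (ℚ × I) → W → ℚ
  comb cs w = sumℚ (map (λ { (c , i) → c *ℚ vec i w }) cs)

  comb-vanish : ∀ cs w → (∀ {c i} → (c , i) ∈ cs → c *ℚ vec i w ≡ 0ℚ) → comb cs w ≡ 0ℚ
  comb-vanish []              w terms-zero = refl
  comb-vanish ((c , i) ∷ cs) w terms-zero =
    trans (cong₂ _+ℚ_ (terms-zero (here refl)) (comb-vanish cs w (λ m → terms-zero (there m)))) (+-identityʳ 0ℚ)

  comb-isolate : ∀ cs w {c i} → Unique (map proj₂ cs) → (c , i) ∈ cs →
    (∀ {c′ j} → (c′ , j) ∈ cs → j ≢ i → c′ *ℚ vec j w ≡ 0ℚ) →
    comb cs w ≡ c *ℚ vec i w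
  comb-isolate ((c , i) ∷ cs) w (i∉cs ∷ _) (here refl) others =
    trans (cong (c *ℚ vec i w +ℚ_) (comb-vanish cs w λ m → others (there m) (λ j≡i → distinct m (sym j≡i))))
          (+-identityʳ _)
    where distinct = All.lookup (All.map⁻ i∉cs)
  comb-isolate ((c′ , j) ∷ cs) w (j∉cs ∷ unique) (there m) others =
    trans (cong₂ _+ℚ_ (others (here refl) (All.lookup (All.map⁻ j∉cs) m))
                      (comb-isolate cs w unique m (λ m′ → others (there m′))))
          (+-identityˡ _)

  triangular-independent : (weight : I → ℕ) (lead : I → W) →
    (∀ i → vec i (lead i) ≡ 1ℚ) →
    (∀ i j → vec j (lead i) ≡ 0ℚ ⊎ j ≡ i ⊎ weight j < weight i) →
    ∀ cs → Unique (map proj₂ cs) → (∀ w → comb cs w ≡ 0ℚ) →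
    All (λ p → proj₁ p ≡ 0ℚ) cs
  triangular-independent weight lead diagonal below cs unique vanish =
    tabulate (λ {p} m → coefficient-zero (weight (proj₂ p)) m refl)
    where
    CoefficientsZero : ℕ → Set
    CoefficientsZero n = ∀ {c i} → (c , i) ∈ cs → weight i ≡ n → c ≡ 0ℚ

    coefficient-zero : ∀ n → CoefficientsZero n
    coefficient-zero = <-rec CoefficientsZero step
      where
      step : ∀ n → (∀ {m} → m < n → CoefficientsZero m) → CoefficientsZero n
      step n smaller {c} {i} m refl = begin
          c                        ≡⟨ sym (*-identityʳ c) ⟩
          c *ℚ 1ℚ                  ≡⟨ cong (c *ℚ_) (sym (diagonal i)) ⟩
          c *ℚ vec i (lead i)      ≡⟨ sym (comb-isolate cs (lead i) unique m others) ⟩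
          comb cs (lead i)         ≡⟨ vanish (lead i) ⟩
          0ℚ                       ∎
        where
        open ≡-Reasoning
        others : ∀ {c′ j} → (c′ , j) ∈ cs → j ≢ i → c′ *ℚ vec j (lead i) ≡ 0ℚ
        others {c′} {j} m′ j≢i with below i j
        ... | inj₁ vanishes        = trans (cong (c′ *ℚ_) vanishes) (*-zeroʳ c′)
        ... | inj₂ (inj₁ j≡i)      = ⊥-elim (j≢i j≡i)
        ... | inj₂ (inj₂ lighter)  =
          trans (cong (_*ℚ vec j (lead i)) (smaller lighter m′ refl)) (*-zeroˡ (vec j (lead i)))

size : PForest → ℕ
size []              = 0
size (node ts ∷ fs) = suc (size ts + size fs)

parents-length : ∀ i par fs → length (parentsF i par fs) ≡ size fs
parents-length i par []              = refl
parents-length i par (node ts ∷ fs) = cong suc (begin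
  length (parentsF (suc i) (just i) ts ++ rest)             ≡⟨ length-++ (parentsF (suc i) (just i) ts) ⟩
  length (parentsF (suc i) (just i) ts) + length rest       ≡⟨ cong₂ _+_ (parents-length (suc i) (just i) ts)
                                                                          (parents-length _ par fs) ⟩
  size ts + size fs                                         ∎)
  where
  open ≡-Reasoning
  rest : List (Maybe ℕ)
  rest = parentsF (i + suc (length (parentsF (suc i) (just i) ts))) par fs

parentLabel : List ℕ → Maybe ℕ → ℕ
parentLabel W nothing  = 0
parentLabel W (just p) = nth W p

ParentBelow : List ℕ → Maybe ℕ × ℕ → Set
ParentBelow W (par , x) = parentLabel W par < x

data Increasing (b : ℕ) : PForest → List ℕ → Set where
  []   : Increasing b [] []
  node : ∀ {x ts fs s s′} → b < x → Increasing x ts s → Increasing b fs s′ →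
         Increasing b (node ts ∷ fs) (x ∷ s ++ s′)

increasing-length : ∀ {b fs w} → Increasing b fs w → length w ≡ size fs
increasing-length []                            = refl
increasing-length (node {s = s} _ inner outer) =
  cong suc (trans (length-++ s) (cong₂ _+_ (increasing-length inner) (increasing-length outer)))

parentOK : List ℕ → Maybe ℕ × ℕ → Bool
parentOK W (nothing , _) = true
parentOK W (just p , x)  = nth W p <ᵇ x

allB-cong : ∀ {A : Set} {f g : A → Bool} → (∀ x → f x ≡ g x) → ∀ xs → allB f xs ≡ allB g xs
allB-cong f≡g []       = refl
allB-cong f≡g (x ∷ xs) = cong₂ _∧_ (f≡g x) (allB-cong f≡g xs)

admissible-unfold : ∀ ps w →
  admissible ps w ≡ ((length ps ≡ᵇ length w) ∧ (allB (0 <ᵇ_) w ∧ allB (parentOK w) (zip ps w)))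
admissible-unfold ps w = cong (λ b → (length ps ≡ᵇ length w) ∧ (allB (0 <ᵇ_) w ∧ b))
  (allB-cong (λ { (nothing , _) → refl ; (just _ , _) → refl }) (zip ps w))

-- Conversely,
-- a label above its parent's label, a natural number, is positive.
checks⇒below : ∀ W ps ws → T (allB (0 <ᵇ_) ws) → T (allB (parentOK W) (zip ps ws)) →
  All (ParentBelow W) (zip ps ws)
checks⇒below W []               ws       _        _      = []
checks⇒below W (_ ∷ _)          []       _        _      = []
checks⇒below W (par ∷ ps) (x ∷ ws) positive ok
  with T-∧ .Equivalence.to positive | T-∧ .Equivalence.to ok
... | x-positive , ws-positive | x-ok , rest-ok = head par x-positive x-ok ∷ checks⇒below W ps ws ws-positive rest-ok
  where
  head : ∀ par → T (0 <ᵇ x) → T (parentOK W (par , x)) → ParentBelow W (par , x)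
  head nothing  x-positive _    = <ᵇ⇒< 0 x x-positive
  head (just p) _          x-ok = <ᵇ⇒< (nth W p) x x-ok

below⇒checks : ∀ W ps ws → length ps ≡ length ws → All (ParentBelow W) (zip ps ws) →
  T (allB (0 <ᵇ_) ws) × T (allB (parentOK W) (zip ps ws))
below⇒checks W []         []       _   _                = tt , tt
below⇒checks W (par ∷ ps) (x ∷ ws) len (above ∷ aboves)
  with below⇒checks W ps ws (suc-injective len) aboves
... | ws-positive , rest-ok =
  T-∧ .Equivalence.from (<⇒<ᵇ (≤-<-trans z≤n above) , ws-positive) ,
  T-∧ .Equivalence.from (head par above , rest-ok)
  where
  head : ∀ par → ParentBelow W (par , x) → T (parentOK W (par , x))
  head nothing  _     = tt
  head (just p) above = <⇒<ᵇ above

admissible⇔below : ∀ ps w → T (admissible ps w) ⇔ (length ps ≡ length w × All (ParentBelow w) (zip ps w))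
admissible⇔below ps w = mk⇔ to from
  where
  unfold : T (admissible ps w) ⇔ T ((length ps ≡ᵇ length w) ∧ (allB (0 <ᵇ_) w ∧ allB (parentOK w) (zip ps w)))
  unfold = subst (λ b → T (admissible ps w) ⇔ T b) (admissible-unfold ps w) (mk⇔ (λ t → t) (λ t → t))

  to : T (admissible ps w) → length ps ≡ length w × All (ParentBelow w) (zip ps w)
  to adm with T-∧ .Equivalence.to (unfold .Equivalence.to adm)
  ... | len , checks with T-∧ .Equivalence.to checks
  ... | positive , ok = ≡ᵇ⇒≡ _ _ len , checks⇒below w ps w positive ok

  from : length ps ≡ length w × All (ParentBelow w) (zip ps w) → T (admissible ps w)
  from (len , aboves) = unfold .Equivalence.from
    (T-∧ .Equivalence.from (≡⇒≡ᵇ _ _ len , T-∧ .Equivalence.from (below⇒checks w ps w len aboves)))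

nth-drop : ∀ i (W : List ℕ) {x r} → drop i W ≡ x ∷ r → nth W i ≡ x
nth-drop zero    (y ∷ W) refl = refl
nth-drop (suc i) (y ∷ W) e    = nth-drop i W e

drop-length-++ : ∀ {A : Set} (s r : List A) → drop (length s) (s ++ r) ≡ r
drop-length-++ []      r = refl
drop-length-++ (x ∷ s) r = drop-length-++ s r

drop-skip : ∀ {A : Set} i (W : List A) s {r} → drop i W ≡ s ++ r → drop (i + length s) W ≡ r
drop-skip i W s {r} e = begin
  drop (i + length s) W           ≡⟨ sym (drop-drop i (length s) W) ⟩
  drop (length s) (drop i W)      ≡⟨ cong (drop (length s)) e ⟩
  drop (length s) (s ++ r)        ≡⟨ drop-length-++ s r ⟩
  r                               ∎
  where open ≡-Reasoning

children-offset : ∀ i (W : List ℕ) {x} s s′ rest →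
  drop i W ≡ x ∷ (s ++ s′) ++ rest → drop (suc i) W ≡ s ++ (s′ ++ rest)
children-offset i W {x} s s′ rest e = subst (λ n → drop n W ≡ s ++ (s′ ++ rest)) (+-comm i 1)
  (trans (drop-skip i W (x ∷ []) e) (++-assoc s s′ rest))

siblings-offset : ∀ i (W : List ℕ) {x} (X : List (Maybe ℕ)) s s′ rest →
  drop i W ≡ x ∷ (s ++ s′) ++ rest → length X ≡ length s → drop (i + suc (length X)) W ≡ s′ ++ rest
siblings-offset i W X s s′ rest e len = subst (λ n → drop n W ≡ s′ ++ rest) offset
  (drop-skip (suc i) W s (children-offset i W s s′ rest e))
  where
  offset : suc i + length s ≡ i + suc (length X)
  offset = trans (cong (λ n → suc (i + n)) (sym len)) (sym (+-suc i (length X)))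

zip-++ : ∀ {A B : Set} (xs ys : List A) {us vs : List B} → length xs ≡ length us →
  zip (xs ++ ys) (us ++ vs) ≡ zip xs us ++ zip ys vs
zip-++ []       ys {[]}     _   = refl
zip-++ (x ∷ xs) ys {u ∷ us} len = cong ((x , u) ∷_) (zip-++ xs ys (suc-injective len))

split-length : ∀ {A : Set} m {n} (xs : List A) → length xs ≡ m + n →
  Σ[ ys ∈ List A ] Σ[ zs ∈ List A ] (xs ≡ ys ++ zs × length ys ≡ m × length zs ≡ n)
split-length zero    xs       len = [] , xs , refl , refl , len
split-length (suc m) (x ∷ xs) len with split-length m xs (suc-injective len)
... | ys , zs , refl , len-ys , len-zs = x ∷ ys , zs , refl , cong suc len-ys , len-zs

increasing⇒below : ∀ i (W : List ℕ) par {fs s} rest → drop i W ≡ s ++ rest →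
  Increasing (parentLabel W par) fs s → All (ParentBelow W) (zip (parentsF i par fs) s)
increasing⇒below i W par rest e [] = []
increasing⇒below i W par rest e (node {x} {ts} {fs} {s} {s′} above inner outer) =
  above ∷ subst (All (ParentBelow W)) (sym (zip-++ X _ len))
    (All.++⁺ (increasing⇒below (suc i) W (just i) (s′ ++ rest) children
               (subst (λ y → Increasing y ts s) (sym label) inner))
             (increasing⇒below _ W par rest siblings outer))
  where
  X : List (Maybe ℕ)
  X = parentsF (suc i) (just i) ts
  len : length X ≡ length s
  len = trans (parents-length (suc i) (just i) ts) (sym (increasing-length inner))
  label : nth W i ≡ x
  label = nth-drop i W e
  children : drop (suc i) W ≡ s ++ (s′ ++ rest)
  children = children-offset i W s s′ rest e
  siblings : drop (i + suc (length X)) W ≡ s′ ++ rest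
  siblings = siblings-offset i W X s s′ rest e len

below⇒increasing : ∀ i (W : List ℕ) par fs {s} rest → drop i W ≡ s ++ rest → length s ≡ size fs →
  All (ParentBelow W) (zip (parentsF i par fs) s) → Increasing (parentLabel W par) fs s
below⇒increasing i W par []             {[]}     rest e len _ = []
below⇒increasing i W par (node ts ∷ fs) {x ∷ s₀} rest e len (above ∷ aboves)
  with split-length (size ts) s₀ (suc-injective len)
... | s , s′ , refl , len-s , len-s′ =
  node above (subst (λ y → Increasing y ts s) label
               (below⇒increasing (suc i) W (just i) ts (s′ ++ rest) children len-s inner-aboves))
             (below⇒increasing _ W par fs rest siblings len-s′ outer-aboves)
  where
  X : List (Maybe ℕ)
  X = parentsF (suc i) (just i) ts
  len-X : length X ≡ length s
  len-X = trans (parents-length (suc i) (just i) ts) (sym len-s)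
  label : nth W i ≡ x
  label = nth-drop i W e
  children : drop (suc i) W ≡ s ++ (s′ ++ rest)
  children = children-offset i W s s′ rest e
  siblings : drop (i + suc (length X)) W ≡ s′ ++ rest
  siblings = siblings-offset i W X s s′ rest e len-X
  split-aboves : All (ParentBelow W) (zip X s) × All (ParentBelow W) (zip (parentsF (i + suc (length X)) par fs) s′)
  split-aboves = All.++⁻ (zip X s) (subst (All (ParentBelow W)) (zip-++ X _ len-X) aboves)
  inner-aboves = proj₁ split-aboves
  outer-aboves = proj₂ split-aboves

admissible⇔increasing : ∀ F w → T (admissible (parents F) w) ⇔ Increasing 0 F w
admissible⇔increasing F w = mk⇔ to from
  where
  whole : drop 0 w ≡ w ++ []
  whole = sym (++-identityʳ w)

  to : T (admissible (parents F) w) → Increasing 0 F w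
  to adm with admissible⇔below (parents F) w .Equivalence.to adm
  ... | len , aboves =
    below⇒increasing 0 w nothing F [] whole (trans (sym len) (parents-length 0 nothing F)) aboves

  from : Increasing 0 F w → T (admissible (parents F) w)
  from inc = admissible⇔below (parents F) w .Equivalence.from
    (trans (parents-length 0 nothing F) (sym (increasing-length inc)) ,
     increasing⇒below 0 w nothing [] whole inc)

depth : ℕ → PForest → List ℕ
depth b []              = []
depth b (node ts ∷ fs) = suc b ∷ depth (suc b) ts ++ depth b fs

depth-increasing : ∀ b fs → Increasing b fs (depth b fs)
depth-increasing b []              = []
depth-increasing b (node ts ∷ fs) = node (n<1+n b) (depth-increasing (suc b) ts) (depth-increasing b fs)

depth-least : ∀ {b c fs w} → Increasing b fs w → c ≤ b → Pointwise _≤_ (depth c fs) w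
depth-least []                        c≤b = []
depth-least {c = c} (node {x} b<x inner outer) c≤b =
  x-above ∷ ++⁺ (depth-least inner x-above) (depth-least outer c≤b)
  where
  x-above : c < x
  x-above = ≤-trans (s≤s c≤b) b<x

-- A forest is determined by its depth word: in the depth word of
-- node ts ∷ fs at level b, the part of ts has entries > b + 1 while the part
-- of fs is empty or starts with b + 1, so the decomposition is unique.  The
-- induction carries a continuation r that is empty or starts with an entry ≤ b.
StartsAtMost : ℕ → List ℕ → Set
StartsAtMost b []      = ⊤
StartsAtMost b (x ∷ _) = x ≤ b

depth-startsAtMost : ∀ b fs {r} → StartsAtMost b r → StartsAtMost (suc b) (depth b fs ++ r)
depth-startsAtMost b []             {[]}    _   = tt
depth-startsAtMost b []             {x ∷ r} x≤b = m≤n⇒m≤1+n x≤b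
depth-startsAtMost b (node _ ∷ _)   _           = ≤-refl

depth-cancel : ∀ b fs fs′ {r r′} → StartsAtMost b r → StartsAtMost b r′ →
  depth b fs ++ r ≡ depth b fs′ ++ r′ → fs ≡ fs′ × r ≡ r′
depth-cancel b [] [] _ _ e = refl , e
depth-cancel b [] (node _ ∷ _) stop _ refl = ⊥-elim (1+n≰n stop)
depth-cancel b (node _ ∷ _) [] _ stop′ refl = ⊥-elim (1+n≰n stop′)
depth-cancel b (node ts ∷ fs) (node ts′ ∷ fs′) {r} {r′} stop stop′ e
  with depth-cancel (suc b) ts ts′ (depth-startsAtMost b fs stop) (depth-startsAtMost b fs′ stop′) (begin
         depth (suc b) ts ++ (depth b fs ++ r)     ≡⟨ sym (++-assoc (depth (suc b) ts) _ r) ⟩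
         (depth (suc b) ts ++ depth b fs) ++ r     ≡⟨ cong (λ { [] → [] ; (_ ∷ tail) → tail }) e ⟩
         (depth (suc b) ts′ ++ depth b fs′) ++ r′  ≡⟨ ++-assoc (depth (suc b) ts′) _ r′ ⟩
         depth (suc b) ts′ ++ (depth b fs′ ++ r′)  ∎)
  where open ≡-Reasoning
... | refl , rest with depth-cancel b fs fs′ stop stop′ rest
...   | refl , refl = refl , refl

depth-injective : ∀ b fs fs′ → depth b fs ≡ depth b fs′ → fs ≡ fs′
depth-injective b fs fs′ e = proj₁ (depth-cancel b fs fs′ tt tt
  (trans (++-identityʳ (depth b fs)) (trans e (sym (++-identityʳ (depth b fs′))))))

sum-mono : ∀ {xs ys} → Pointwise _≤_ xs ys → sum xs ≤ sum ys
sum-mono []       = z≤n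
sum-mono (x≤y ∷ ps) = +-mono-≤ x≤y (sum-mono ps)

sum-rigid : ∀ {xs ys} → Pointwise _≤_ xs ys → sum xs ≡ sum ys → xs ≡ ys
sum-rigid [] _ = refl
sum-rigid {x ∷ xs} {y ∷ ys} (x≤y ∷ ps) e = cong₂ _∷_ x≡y (sum-rigid ps (+-cancelˡ-≡ x _ _ e′))
  where
  open ≤-Reasoning
  x≡y : x ≡ y
  x≡y = ≤-antisym x≤y (+-cancelʳ-≤ (sum ys) y x (begin
    y + sum ys  ≡⟨ sym e ⟩
    x + sum xs  ≤⟨ +-monoʳ-≤ x (sum-mono ps) ⟩
    x + sum ys  ∎))
  e′ : x + sum xs ≡ x + sum ys
  e′ = trans e (cong (_+ sum ys) (sym x≡y))

depth-below : ∀ b G F → Pointwise _≤_ (depth b G) (depth b F) →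
  G ≡ F ⊎ sum (depth b G) < sum (depth b F)
depth-below b G F below with m≤n⇒m<n∨m≡n (sum-mono below)
... | inj₁ lighter = inj₂ lighter
... | inj₂ same    = inj₁ (depth-injective b G F (sum-rigid below same))

weight : PForest → ℕ
weight F = sum (depth 0 F)

coeff-cases : ∀ F w → coeff F w ≡ 0ℚ ⊎ T (admissible (parents F) w)
coeff-cases F w with admissible (parents F) w
... | true  = inj₂ tt
... | false = inj₁ refl

coeff-admissible : ∀ F w → T (admissible (parents F) w) → coeff F w ≡ 1ℚ
coeff-admissible F w adm with admissible (parents F) w
... | true  = refl
... | false = ⊥-elim adm

coeff-depth : ∀ F → coeff F (depth 0 F) ≡ 1ℚ
coeff-depth F = coeff-admissible F (depth 0 F)
  (admissible⇔increasing F (depth 0 F) .Equivalence.from (depth-increasing 0 F))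

-- If the depth word of F occurs in π(S^G), it is an increasing labelling of
-- G, hence lies above the depth word of G.
coeff-triangular : ∀ F G → coeff G (depth 0 F) ≡ 0ℚ ⊎ G ≡ F ⊎ weight G < weight F
coeff-triangular F G with coeff-cases G (depth 0 F)
... | inj₁ vanishes = inj₁ vanishes
... | inj₂ adm      =
  inj₂ (depth-below 0 G F (depth-least (admissible⇔increasing G (depth 0 F) .Equivalence.to adm) z≤n))

theorem3p3 : (cs : List (ℚ × PForest)) →
    Unique (map proj₂ cs) →
    (∀ (w : List ℕ) → combCoeff cs w ≡ 0ℚ) →
    All (λ p → proj₁ p ≡ 0ℚ) cs
theorem3p3 cs unique vanish =
  triangular-independent weight (depth 0) coeff-depth coeff-triangular cs unique vanish
  where open Triangular coeff
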